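{- Let $H$ and $H'$ be ordered forests. Then $R_<(H,H')$ does not contain a forest in each of the following cases: (a) both $H$ and $H'$ contain a component that is not a star; (b) one of $H$ or $H'$ contains a vertex with two neighbors to its right and the other contains a vertex with two neighbors to its left; (c) both $H$ and $H'$ contain a monotone path on two edges; (d) one of $H$ and $H'$ contains a copy of a monotone $P_3$ and the other contains a copy of some ordered $P_4$ (a path on four vertices with any vertex order).
   Context: An ordered graph is a finite simple graph together with a linear order of its vertex set; an ordered forest is an ordered graph without cycles. A copy of an ordered graph $H$ in $F$ is a subgraph of $F$ (with inherited order) isomorphic to $H$ via an order-preserving bijection. $R_<(H,H')$ is the set of ordered graphs $F$ such that every red/blue coloring of the edges of $F$ contains a red copy of $H$ or a blue copy of $H'$. A monotone path is an ordered path $u_1\cdots u_n$ with $u_1<\cdots<u_n$; a monotone $P_3$ is a monotone path on three vertices (two edges). -}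

module Defs where

open import Data.Nat using (ℕ; zero; suc)
open import Data.Fin using (Fin; zero; suc; _<_; inject₁; fromℕ)
open import Data.Bool using (Bool; true; false)
open import Data.Product using (Σ; ∃; _×_; _,_)
open import Data.Sum using (_⊎_)
open import Relation.Binary.PropositionalEquality using (_≡_; _≢_)
open import Relation.Nullary using (¬_)
open import Function.Definitions using (Injective)

-- An ordered graph: vertex set Fin size, ordered by the natural order of Fin;
-- a finite simple graph given by a symmetric irreflexive Boolean adjacency.
record OGraph : Set where
  field
    size : ℕ
    adj  : Fin size → Fin size → Bool
    adj-sym : ∀ i j → adj i j ≡ adj j i
    adj-irr : ∀ i → adj i i ≡ false
open OGraph public

Edge : (G : OGraph) → Fin (size G) → Fin (size G) → Set
Edge G i j = adj G i j ≡ true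

IsCycle : (G : OGraph) (k : ℕ) → (Fin (suc (suc (suc k))) → Fin (size G)) → Set
IsCycle G k g =
  Injective _≡_ _≡_ g
  × (∀ (i : Fin (suc (suc k))) → Edge G (g (inject₁ i)) (g (suc i)))
  × Edge G (g (fromℕ (suc (suc k)))) (g zero)

IsForest : OGraph → Set
IsForest G = ∀ (k : ℕ) (g : Fin (suc (suc (suc k))) → Fin (size G)) → ¬ IsCycle G k g

StrictMono : ∀ {m n} → (Fin m → Fin n) → Set
StrictMono f = ∀ i j → i < j → f i < f j

IsCopy : (H G : OGraph) → (Fin (size H) → Fin (size G)) → Set
IsCopy H G f = StrictMono f × (∀ i j → Edge H i j → Edge G (f i) (f j))

Contains : (G H : OGraph) → Set
Contains G H = Σ (Fin (size H) → Fin (size G)) (IsCopy H G)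

-- Red/blue edge colourings of G (true = red, false = blue); symmetric so
-- that each (unordered) edge receives one colour.
record Colouring (G : OGraph) : Set where
  field
    col : Fin (size G) → Fin (size G) → Bool
    col-sym : ∀ i j → col i j ≡ col j i
open Colouring public

MonoCopy : (H G : OGraph) → Colouring G → Bool → Set
MonoCopy H G c b = Σ (Fin (size H) → Fin (size G)) λ f →
  StrictMono f × (∀ i j → Edge H i j → Edge G (f i) (f j) × col c (f i) (f j) ≡ b)

InRamsey : (H H' F : OGraph) → Set
InRamsey H H' F = ∀ (c : Colouring F) → MonoCopy H F c true ⊎ MonoCopy H' F c false

data Reach (G : OGraph) : Fin (size G) → Fin (size G) → Set where
  here : ∀ {u} → Reach G u u
  step : ∀ {u w v} → Edge G u w → Reach G w v → Reach G u v

-- The component of v is a star (K_{1,t}, t ≥ 0, including an isolated vertex):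
-- there is a centre in it to which every edge of the component is incident.
ComponentIsStar : (G : OGraph) → Fin (size G) → Set
ComponentIsStar G v = Σ (Fin (size G)) λ c → Reach G v c ×
  (∀ x y → Reach G v x → Edge G x y → (x ≡ c) ⊎ (y ≡ c))

HasNonStarComponent : OGraph → Set
HasNonStarComponent G = Σ (Fin (size G)) λ v → ¬ ComponentIsStar G v

HasRightCherry : OGraph → Set
HasRightCherry G = Σ (Fin (size G)) λ v → Σ (Fin (size G)) λ a → Σ (Fin (size G)) λ b →
  v < a × a < b × Edge G v a × Edge G v b

HasLeftCherry : OGraph → Set
HasLeftCherry G = Σ (Fin (size G)) λ v → Σ (Fin (size G)) λ a → Σ (Fin (size G)) λ b →
  a < b × b < v × Edge G a v × Edge G b v

monoP3adj : Fin 3 → Fin 3 → Bool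
monoP3adj zero (suc zero) = true
monoP3adj (suc zero) zero = true
monoP3adj (suc zero) (suc (suc zero)) = true
monoP3adj (suc (suc zero)) (suc zero) = true
monoP3adj _ _ = false

monoP3 : OGraph
monoP3 = record
  { size = 3
  ; adj = monoP3adj
  ; adj-sym = sym'
  ; adj-irr = irr'
  }
  where
  sym' : ∀ i j → monoP3adj i j ≡ monoP3adj j i
  sym' zero zero = _≡_.refl
  sym' zero (suc zero) = _≡_.refl
  sym' zero (suc (suc zero)) = _≡_.refl
  sym' (suc zero) zero = _≡_.refl
  sym' (suc zero) (suc zero) = _≡_.refl
  sym' (suc zero) (suc (suc zero)) = _≡_.refl
  sym' (suc (suc zero)) zero = _≡_.refl
  sym' (suc (suc zero)) (suc zero) = _≡_.refl
  sym' (suc (suc zero)) (suc (suc zero)) = _≡_.refl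
  irr' : ∀ i → monoP3adj i i ≡ false
  irr' zero = _≡_.refl
  irr' (suc zero) = _≡_.refl
  irr' (suc (suc zero)) = _≡_.refl

ContainsSomeP4 : OGraph → Set
ContainsSomeP4 G = Σ (Fin (size G)) λ u₁ → Σ (Fin (size G)) λ u₂ →
  Σ (Fin (size G)) λ u₃ → Σ (Fin (size G)) λ u₄ →
  (u₁ ≢ u₂ × u₁ ≢ u₃ × u₁ ≢ u₄ × u₂ ≢ u₃ × u₂ ≢ u₄ × u₃ ≢ u₄)
  × Edge G u₁ u₂ × Edge G u₂ u₃ × Edge G u₃ u₄

-- Every forest F can be rooted: a forest always has a vertex of degree at most one (otherwise a
-- non-backtracking walk closes a cycle), and ranking the vertices in an order of leaf removal
-- gives every vertex at most one neighbour of higher rank, its parent, together with a proper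
-- 2-colouring (parity). Each case is refuted by a colouring of F:
-- (a) colour the edge from x to its parent by the parity of x; a vertex of that parity meets only
--     its parent edge in that colour, so every monochromatic subgraph is a disjoint union of stars;
-- (b) colour the edge from x to its parent p red iff x < p; a red vertex with two neighbours to its
--     right would have two parents, and dually for blue;
-- (c) colour each edge by the parity of its left end; the edges of a monotone P3 then differ;
-- (d) colour the edge from x to its parent p red iff x lies on the same side of p as the parent of
--     p. A red monotone P3 would put the parent of its middle vertex on both sides; in blue every
--     vertex sees its children on the side opposite its parent, which excludes any P4 whose two
--     inner vertices each see their path neighbours on one side. Every other P4 contains a
--     monotone P3, and then (c) applies.

module Submission where

open import Defs
open import Data.Nat as ℕ using (ℕ; zero; suc; _+_; s≤s; z≤n)
open import Data.Nat.Properties as ℕ using ()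
open import Data.Nat.Induction using (<-wellFounded)
open import Induction.WellFounded using (Acc; acc)
open import Data.Fin using (Fin; zero; suc; toℕ; _<_; fromℕ<; inject₁; fromℕ)
open import Data.Fin.Properties
  using (_≟_; _<?_; <-cmp; <-asym; <-irrefl; <-trans; any?; pigeonhole; toℕ<n; toℕ-injective;
         toℕ-inject₁; toℕ-fromℕ; toℕ-fromℕ<)
open import Data.Fin.Subset using (Subset; _∈_; _-_; ∣_∣; ⊤; Nonempty)
open import Data.Fin.Subset.Properties using (_∈?_; nonempty?; ∈⊤; x∈p∧x≢y⇒x∈p-y; x∈p⇒∣p-x∣<∣p∣)
open import Data.Bool using (Bool; true; false; not; if_then_else_)
open import Data.Bool.Properties using (not-¬; ¬-not) renaming (_≟_ to _≟ᵇ_)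
open import Data.Product using (∃; ∃₂; _×_; _,_; proj₁; proj₂)
open import Data.Sum using (_⊎_; inj₁; inj₂; [_,_]′)
open import Data.Empty using (⊥)
open import Function using (_∘_)
open import Relation.Binary using (tri<; tri≈; tri>)
open import Relation.Binary.PropositionalEquality
open import Relation.Nullary using (¬_; Dec; yes; no; does; contradiction; ¬?)
open import Relation.Nullary.Decidable using (_×-dec_; decidable-stable; dec-true; dec-false)

module _ (G : OGraph) where

  Edge-sym : ∀ {a b} → Edge G a b → Edge G b a
  Edge-sym {a} {b} e = trans (adj-sym G b a) e

  Edge-irrefl : ∀ {a} → ¬ Edge G a a
  Edge-irrefl {a} e with () ← trans (sym (adj-irr G a)) e

  Edge? : ∀ a b → Dec (Edge G a b)
  Edge? a b = adj G a b ≟ᵇ true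

strictMono⇒injective : ∀ {m n} {f : Fin m → Fin n} → StrictMono f → ∀ {i j} → f i ≡ f j → i ≡ j
strictMono⇒injective sm {i} {j} eq with <-cmp i j
... | tri< i<j _ _ = contradiction (cong toℕ eq) (ℕ.<⇒≢ (sm i j i<j))
... | tri≈ _ i≡j _ = i≡j
... | tri> _ _ j<i = contradiction (cong toℕ (sym eq)) (ℕ.<⇒≢ (sm j i j<i))

monoCopy-∘ : ∀ {H K F c β} → Contains H K → MonoCopy H F c β → MonoCopy K F c β
monoCopy-∘ (h , h-mono , h-edge) (f , f-mono , f-edge) =
  f ∘ h , (λ i j i<j → f-mono _ _ (h-mono i j i<j)) , (λ i j e → f-edge _ _ (h-edge i j e))

colouring⇒∉Ramsey : ∀ H H' {F} (c : Colouring F) →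
  ¬ MonoCopy H F c true → ¬ MonoCopy H' F c false → ¬ InRamsey H H' F
colouring⇒∉Ramsey _ _ c noRed noBlue ramsey = [ noRed , noBlue ]′ (ramsey c)

module _ (K : OGraph) where

  monotonePath⇒monoP3 : ∀ {a b c} → a < b → b < c → Edge K a b → Edge K b c → Contains K monoP3
  monotonePath⇒monoP3 {a} {b} {c} a<b b<c ab bc = path , mono , edge
    where
    path : Fin 3 → Fin (size K)
    path zero = a
    path (suc zero) = b
    path (suc (suc zero)) = c
    mono : StrictMono path
    mono zero (suc zero) _ = a<b
    mono zero (suc (suc zero)) _ = <-trans a<b b<c
    mono (suc zero) (suc (suc zero)) _ = b<c
    mono zero zero ()
    mono (suc zero) zero ()
    mono (suc zero) (suc zero) (s≤s ())
    mono (suc (suc zero)) zero ()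
    mono (suc (suc zero)) (suc zero) (s≤s ())
    mono (suc (suc zero)) (suc (suc zero)) (s≤s (s≤s ()))
    edge : ∀ i j → Edge monoP3 i j → Edge K (path i) (path j)
    edge zero (suc zero) _ = ab
    edge (suc zero) zero _ = Edge-sym K ab
    edge (suc zero) (suc (suc zero)) _ = bc
    edge (suc (suc zero)) (suc zero) _ = Edge-sym K bc
    edge zero zero ()
    edge zero (suc (suc zero)) ()
    edge (suc zero) (suc zero) ()
    edge (suc (suc zero)) zero ()
    edge (suc (suc zero)) (suc (suc zero)) ()

SameSide : ∀ {n} → Fin n → Fin n → Fin n → Set
SameSide a m c = (a < m × c < m) ⊎ (m < a × m < c)

module _ (K : OGraph) where

  path⇒monoP3⊎sameSide : ∀ {a m c} → Edge K a m → Edge K m c → Contains K monoP3 ⊎ SameSide a m c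
  path⇒monoP3⊎sameSide {a} {m} {c} am mc with <-cmp a m | <-cmp c m
  ... | tri≈ _ refl _ | _ = contradiction am (Edge-irrefl K)
  ... | _ | tri≈ _ refl _ = contradiction mc (Edge-irrefl K)
  ... | tri< a<m _ _ | tri< c<m _ _ = inj₂ (inj₁ (a<m , c<m))
  ... | tri> _ _ m<a | tri> _ _ m<c = inj₂ (inj₂ (m<a , m<c))
  ... | tri< a<m _ _ | tri> _ _ m<c = inj₁ (monotonePath⇒monoP3 K a<m m<c am mc)
  ... | tri> _ _ m<a | tri< c<m _ _ =
    inj₁ (monotonePath⇒monoP3 K c<m m<a (Edge-sym K mc) (Edge-sym K am))

  record ZigzagP4 : Set where
    field
      q₁ q₂ q₃ q₄ : Fin (size K)
      q₁≢q₃ : q₁ ≢ q₃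
      q₂≢q₄ : q₂ ≢ q₄
      q₁q₂ : Edge K q₁ q₂
      q₂q₃ : Edge K q₂ q₃
      q₃q₄ : Edge K q₃ q₄
      bend₂ : SameSide q₁ q₂ q₃
      bend₃ : SameSide q₂ q₃ q₄

  someP4⇒monoP3⊎zigzag : ContainsSomeP4 K → Contains K monoP3 ⊎ ZigzagP4
  someP4⇒monoP3⊎zigzag (q₁ , q₂ , q₃ , q₄ , (_ , q₁≢q₃ , _ , _ , q₂≢q₄ , _) , q₁q₂ , q₂q₃ , q₃q₄)
    with path⇒monoP3⊎sameSide q₁q₂ q₂q₃ | path⇒monoP3⊎sameSide q₂q₃ q₃q₄
  ... | inj₁ mono | _ = inj₁ mono
  ... | inj₂ _ | inj₁ mono = inj₁ mono
  ... | inj₂ bend₂ | inj₂ bend₃ = inj₂ (record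
    { q₁≢q₃ = q₁≢q₃ ; q₂≢q₄ = q₂≢q₄ ; q₁q₂ = q₁q₂ ; q₂q₃ = q₂q₃ ; q₃q₄ = q₃q₄
    ; bend₂ = bend₂ ; bend₃ = bend₃ })

  DegreeAtMostOne : Fin (size K) → Set
  DegreeAtMostOne x = ∀ {y z} → Edge K x y → Edge K x z → y ≡ z

  module _ (leafy : ∀ {x y} → Edge K x y → DegreeAtMostOne x ⊎ DegreeAtMostOne y) where

    private
      module Around {ℓ c} (ℓ-leaf : DegreeAtMostOne ℓ) (ℓc : Edge K ℓ c) where
        Spoke : Fin (size K) → Set
        Spoke x = x ≡ c ⊎ (Edge K x c × DegreeAtMostOne x)

        spoke-step : ∀ {x y} → Spoke x → Edge K x y → Spoke y
        spoke-step (inj₁ refl) cy with leafy cy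
        ... | inj₁ c-leaf rewrite c-leaf cy (Edge-sym K ℓc) = inj₂ (ℓc , ℓ-leaf)
        ... | inj₂ y-leaf = inj₂ (Edge-sym K cy , y-leaf)
        spoke-step (inj₂ (xc , x-leaf)) xy = inj₁ (x-leaf xy xc)

        spoke-reach : ∀ {x y} → Spoke x → Reach K x y → Spoke y
        spoke-reach s here = s
        spoke-reach s (step e r) = spoke-reach (spoke-step s e) r

        star : ∀ {v} → Spoke v → Reach K v c → ComponentIsStar K v
        star {v} sv vc = c , vc , λ x y vx xy → centred (spoke-reach sv vx) xy
          where
          centred : ∀ {x y} → Spoke x → Edge K x y → x ≡ c ⊎ y ≡ c
          centred (inj₁ x≡c) _ = inj₁ x≡c
          centred (inj₂ (xc , x-leaf)) xy = inj₂ (x-leaf xy xc)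

    leafy⇒componentIsStar : ∀ v → ComponentIsStar K v
    leafy⇒componentIsStar v with any? (Edge? K v)
    ... | no isolated = v , here , λ where
      _ _ here e → contradiction (_ , e) isolated
      _ _ (step e _) _ → contradiction (_ , e) isolated
    ... | yes (w , vw) with leafy vw
    ...   | inj₁ v-leaf = Around.star v-leaf vw (inj₂ (vw , v-leaf)) (step vw here)
    ...   | inj₂ w-leaf = Around.star w-leaf (Edge-sym K vw) (inj₁ refl) here

-- Forests: leaves and rootings

InjectiveBelow : ∀ {n} → (ℕ → Fin n) → ℕ → Set
InjectiveBelow x m = ∀ {i j} → i ℕ.< m → j ℕ.< m → x i ≡ x j → i ≡ j

FirstRepetition : ∀ {n} → (ℕ → Fin n) → Set
FirstRepetition x = ∃₂ λ i j → i ℕ.< j × x i ≡ x j × InjectiveBelow x j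

injectiveBelow⊎firstRepetition : ∀ {n} (x : ℕ → Fin n) m → InjectiveBelow x m ⊎ FirstRepetition x
injectiveBelow⊎firstRepetition x zero = inj₁ λ ()
injectiveBelow⊎firstRepetition x (suc m) with injectiveBelow⊎firstRepetition x m
... | inj₂ rep = inj₂ rep
... | inj₁ inj with any? (λ (i : Fin m) → x (toℕ i) ≟ x m)
...   | yes (i , xi≡xm) = inj₂ (toℕ i , m , toℕ<n i , xi≡xm , inj)
...   | no new = inj₁ inj′
  where
  new′ : ∀ {i} → i ℕ.< m → x i ≢ x m
  new′ i<m eq = new (fromℕ< i<m , subst (λ i → x i ≡ x m) (sym (toℕ-fromℕ< i<m)) eq)
  inj′ : InjectiveBelow x (suc m)
  inj′ {i} {j} i<1+m j<1+m eq with ℕ.m≤n⇒m<n∨m≡n (ℕ.s≤s⁻¹ i<1+m) | ℕ.m≤n⇒m<n∨m≡n (ℕ.s≤s⁻¹ j<1+m)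
  ... | inj₁ i<m  | inj₁ j<m  = inj i<m j<m eq
  ... | inj₁ i<m  | inj₂ refl = contradiction eq (new′ i<m)
  ... | inj₂ refl | inj₁ j<m  = contradiction (sym eq) (new′ j<m)
  ... | inj₂ refl | inj₂ refl = refl

firstRepetition : ∀ {n} (x : ℕ → Fin n) → FirstRepetition x
firstRepetition {n} x with injectiveBelow⊎firstRepetition x (suc n)
... | inj₂ rep = rep
... | inj₁ inj with pigeonhole (ℕ.n<1+n n) (x ∘ toℕ)
...   | i , j , i<j , eq = contradiction (inj (toℕ<n i) (toℕ<n j) eq) (ℕ.<⇒≢ i<j)

module _ (G : OGraph) where

  NonBacktracking : (ℕ → Fin (size G)) → Set
  NonBacktracking x = (∀ k → Edge G (x k) (x (suc k))) × (∀ k → x (suc (suc k)) ≢ x k)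

  closedNonBacktracking⇒cycle : ∀ {x} k → NonBacktracking x →
    InjectiveBelow x (3 + k) → x (3 + k) ≡ x 0 → IsCycle G k (x ∘ toℕ)
  closedNonBacktracking⇒cycle {x} k (edge , _) inj closed =
    (λ eq → toℕ-injective (inj (toℕ<n _) (toℕ<n _) eq)) , edges , closing
    where
    edges : ∀ (t : Fin (2 + k)) → Edge G (x (toℕ (inject₁ t))) (x (suc (toℕ t)))
    edges t rewrite toℕ-inject₁ t = edge (toℕ t)
    closing : Edge G (x (toℕ (fromℕ (2 + k)))) (x 0)
    closing rewrite toℕ-fromℕ (2 + k) = subst (Edge G (x (2 + k))) closed (edge (2 + k))

  forest⇒¬nonBacktracking : IsForest G → ∀ x → ¬ NonBacktracking x
  forest⇒¬nonBacktracking forest x walk with firstRepetition x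
  ... | i , j , i<j , xi≡xj , inj with ℕ.m≤n⇒∃[o]m+o≡n i<j
  ... | d , refl = closed d shiftedInj (sym xi≡xj′)
    where
    y : ℕ → Fin (size G)
    y t = x (t + i)
    i+d≡d+i : suc (i + d) ≡ suc (d + i)
    i+d≡d+i = cong suc (ℕ.+-comm i d)
    xi≡xj′ : x i ≡ y (suc d)
    xi≡xj′ = subst (λ j → x i ≡ x j) i+d≡d+i xi≡xj
    shiftedInj : InjectiveBelow y (suc d)
    shiftedInj t<1+d u<1+d eq = ℕ.+-cancelʳ-≡ i _ _
      (subst (InjectiveBelow x) i+d≡d+i inj (ℕ.+-monoˡ-< i t<1+d) (ℕ.+-monoˡ-< i u<1+d) eq)
    shiftedWalk : NonBacktracking y
    shiftedWalk = (λ k → proj₁ walk (k + i)) , (λ k → proj₂ walk (k + i))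
    closed : ∀ d → InjectiveBelow y (suc d) → y (suc d) ≡ y 0 → ⊥
    closed zero _ y₁≡y₀ = Edge-irrefl G (subst (Edge G (y 0)) y₁≡y₀ (proj₁ shiftedWalk 0))
    closed (suc zero) _ y₂≡y₀ = proj₂ shiftedWalk 0 y₂≡y₀
    closed (suc (suc k)) inj′ closes =
      forest k (y ∘ toℕ) (closedNonBacktracking⇒cycle k shiftedWalk inj′ closes)

  AtMostOneNeighbourIn : Subset (size G) → Fin (size G) → Set
  AtMostOneNeighbourIn p v = ∃ λ u → ∀ {w} → w ∈ p → Edge G v w → w ≡ u

  EscapesFrom : Subset (size G) → Fin (size G) → Fin (size G) → Set
  EscapesFrom p v u = ∃ λ w → w ∈ p × Edge G v w × w ≢ u

  escapesFrom? : ∀ p v u → Dec (EscapesFrom p v u)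
  escapesFrom? p v u = any? λ w → w ∈? p ×-dec Edge? G v w ×-dec ¬? (w ≟ u)

  escaping⇒nonBacktracking : ∀ {p v₀} → v₀ ∈ p → (∀ {v} → v ∈ p → ∀ u → EscapesFrom p v u) →
    ∃ NonBacktracking
  escaping⇒nonBacktracking {p} {v₀} v₀∈p escape = x , edge , noReturn
    where
    State : Set
    State = Fin (size G) × ∃ (_∈ p)
    escapeFrom : (s : State) → EscapesFrom p (proj₁ (proj₂ s)) (proj₁ s)
    escapeFrom (u , v , v∈p) = escape v∈p u
    advance : State → State
    advance s = proj₁ (proj₂ s) , proj₁ (escapeFrom s) , proj₁ (proj₂ (escapeFrom s))
    trail : ℕ → State
    trail zero = v₀ , v₀ , v₀∈p
    trail (suc k) = advance (trail k)
    x : ℕ → Fin (size G)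
    x = proj₁ ∘ proj₂ ∘ trail
    edge : ∀ k → Edge G (x k) (x (suc k))
    edge = proj₁ ∘ proj₂ ∘ proj₂ ∘ escapeFrom ∘ trail
    noReturn : ∀ k → x (suc (suc k)) ≢ x k
    noReturn = proj₂ ∘ proj₂ ∘ proj₂ ∘ escapeFrom ∘ trail ∘ suc

  forest⇒leaf : IsForest G → ∀ p → Nonempty p → ∃ λ v → v ∈ p × AtMostOneNeighbourIn p v
  forest⇒leaf forest p (v₀ , v₀∈p)
    with any? (λ v → v ∈? p ×-dec any? (λ u → ¬? (escapesFrom? p v u)))
  ... | yes (v , v∈p , u , stuck) = v , v∈p , u , λ {w} w∈p e →
          decidable-stable (w ≟ u) (λ w≢u → stuck (w , w∈p , e , w≢u))
  ... | no noLeaf = contradiction (proj₂ (escaping⇒nonBacktracking v₀∈p escape))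
                                 (forest⇒¬nonBacktracking forest _)
    where
    escape : ∀ {v} → v ∈ p → ∀ u → EscapesFrom p v u
    escape {v} v∈p u = decidable-stable (escapesFrom? p v u) λ stuck → noLeaf (v , v∈p , u , stuck)

  record Rooting (p : Subset (size G)) : Set where
    field
      rank   : Fin (size G) → ℕ
      parity : Fin (size G) → Bool
      rank-≢   : ∀ {a b} → a ∈ p → b ∈ p → Edge G a b → rank a ≢ rank b
      parity-≢ : ∀ {a b} → a ∈ p → b ∈ p → Edge G a b → parity a ≢ parity b
      ascent   : ∀ {a} → a ∈ p → ∃ λ u → ∀ {w} → w ∈ p → Edge G a w → rank a ℕ.< rank w → w ≡ u

  emptyRooting : ∀ {p} → ¬ Nonempty p → Rooting p
  emptyRooting empty = record
    { rank = λ _ → 0 ; parity = λ _ → false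
    ; rank-≢ = λ a∈p → contradiction (_ , a∈p) empty
    ; parity-≢ = λ a∈p → contradiction (_ , a∈p) empty
    ; ascent = λ a∈p → contradiction (_ , a∈p) empty
    }

  module AddLeaf {p v u} (leaf : ∀ {w} → w ∈ p → Edge G v w → w ≡ u) (R : Rooting (p - v)) where
    private
      module R = Rooting R

    -- Deciding v ≟ i rather than i ≟ v keeps the case splits on a ≟ v below from unfolding rank.
    rank : Fin (size G) → ℕ
    rank i = if does (v ≟ i) then 0 else suc (R.rank i)

    parity : Fin (size G) → Bool
    parity i = if does (v ≟ i) then not (R.parity u) else R.parity i

    rank-v : rank v ≡ 0
    rank-v rewrite dec-true (v ≟ v) refl = refl

    parity-v : parity v ≡ not (R.parity u)
    parity-v rewrite dec-true (v ≟ v) refl = refl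

    rank-old : ∀ {i} → i ≢ v → rank i ≡ suc (R.rank i)
    rank-old i≢v rewrite dec-false (v ≟ _) (i≢v ∘ sym) = refl

    parity-old : ∀ {i} → i ≢ v → parity i ≡ R.parity i
    parity-old i≢v rewrite dec-false (v ≟ _) (i≢v ∘ sym) = refl

    old : ∀ {i} → i ∈ p → i ≢ v → i ∈ p - v
    old = x∈p∧x≢y⇒x∈p-y

    rank-≢-v : ∀ {b} → b ≢ v → rank v ≢ rank b
    rank-≢-v b≢v eq with () ← trans (sym rank-v) (trans eq (rank-old b≢v))

    parity-≢-v : ∀ {b} → b ∈ p → b ≢ v → Edge G v b → parity v ≢ parity b
    parity-≢-v b∈p b≢v e eq with refl ← leaf b∈p e =
      not-¬ refl (trans (trans (sym (parity-old b≢v)) (sym eq)) parity-v)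

    rank-≢ : ∀ {a b} → a ∈ p → b ∈ p → Edge G a b → rank a ≢ rank b
    rank-≢ {a} {b} a∈p b∈p e with a ≟ v | b ≟ v
    ... | yes refl | yes refl = contradiction e (Edge-irrefl G)
    ... | yes refl | no b≢v  = rank-≢-v b≢v
    ... | no a≢v  | yes refl = rank-≢-v a≢v ∘ sym
    ... | no a≢v  | no b≢v  = R.rank-≢ (old a∈p a≢v) (old b∈p b≢v) e
                               ∘ ℕ.suc-injective ∘ subst₂ _≡_ (rank-old a≢v) (rank-old b≢v)

    parity-≢ : ∀ {a b} → a ∈ p → b ∈ p → Edge G a b → parity a ≢ parity b
    parity-≢ {a} {b} a∈p b∈p e with a ≟ v | b ≟ v
    ... | yes refl | yes refl = contradiction e (Edge-irrefl G)
    ... | yes refl | no b≢v  = parity-≢-v b∈p b≢v e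
    ... | no a≢v  | yes refl = parity-≢-v a∈p a≢v (Edge-sym G e) ∘ sym
    ... | no a≢v  | no b≢v  = R.parity-≢ (old a∈p a≢v) (old b∈p b≢v) e
                               ∘ subst₂ _≡_ (parity-old a≢v) (parity-old b≢v)

    ascent : ∀ {a} → a ∈ p → ∃ λ u → ∀ {w} → w ∈ p → Edge G a w → rank a ℕ.< rank w → w ≡ u
    ascent {a} a∈p with a ≟ v
    ... | yes refl = u , λ w∈p e _ → leaf w∈p e
    ... | no a≢v = proj₁ (R.ascent (old a∈p a≢v)) , up
      where
      up : ∀ {w} → w ∈ p → Edge G a w → rank a ℕ.< rank w → w ≡ proj₁ (R.ascent (old a∈p a≢v))
      up {w} w∈p e a<w with w ≟ v
      ... | yes refl = contradiction (subst (rank a ℕ.<_) rank-v a<w) ℕ.n≮0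
      ... | no w≢v = proj₂ (R.ascent (old a∈p a≢v)) (old w∈p w≢v) e
                       (ℕ.s<s⁻¹ (subst₂ ℕ._<_ (rank-old a≢v) (rank-old w≢v) a<w))

    rooting : Rooting p
    rooting = record
      { rank = rank ; parity = parity ; rank-≢ = rank-≢ ; parity-≢ = parity-≢ ; ascent = ascent }

  forest⇒rootingOn : IsForest G → ∀ p → Acc ℕ._<_ ∣ p ∣ → Rooting p
  forest⇒rootingOn forest p (acc smaller) with nonempty? p
  ... | no empty = emptyRooting empty
  ... | yes nonempty with forest⇒leaf forest p nonempty
  ...   | v , v∈p , _ , leaf =
    AddLeaf.rooting leaf (forest⇒rootingOn forest (p - v) (smaller (x∈p⇒∣p-x∣<∣p∣ v∈p)))

  forest⇒rooting : IsForest G → Rooting ⊤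
  forest⇒rooting forest = forest⇒rootingOn forest ⊤ (<-wellFounded _)

-- Colourings of a rooted forest

record MonotoneP3 (F : OGraph) (κ : Colouring F) (β : Bool) : Set where
  field
    {a m c} : Fin (size F)
    a<m : a < m
    m<c : m < c
    am : Edge F a m
    mc : Edge F m c
    am-β : col κ a m ≡ β
    mc-β : col κ m c ≡ β

monoCopy⇒monotoneP3 : ∀ {K F κ β} → Contains K monoP3 → MonoCopy K F κ β → MonotoneP3 F κ β
monoCopy⇒monotoneP3 {K} {F} {κ} {β} p3 copy with monoCopy-∘ {K} {monoP3} {F} {κ} {β} p3 copy
... | f , mono , edge = record
  { a<m = mono zero (suc zero) (s≤s z≤n)
  ; m<c = mono (suc zero) (suc (suc zero)) (s≤s (s≤s z≤n))
  ; am = proj₁ (edge zero (suc zero) refl)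
  ; mc = proj₁ (edge (suc zero) (suc (suc zero)) refl)
  ; am-β = proj₂ (edge zero (suc zero) refl)
  ; mc-β = proj₂ (edge (suc zero) (suc (suc zero)) refl)
  }

module _ {n} (key : Fin n → ℕ) (g : Fin n → Fin n → Bool) where

  keyed : Fin n → Fin n → Bool
  keyed i j with ℕ.<-cmp (key i) (key j)
  ... | tri< _ _ _ = g i j
  ... | tri≈ _ _ _ = false
  ... | tri> _ _ _ = g j i

  keyed-< : ∀ {i j} → key i ℕ.< key j → keyed i j ≡ g i j
  keyed-< {i} {j} lt with ℕ.<-cmp (key i) (key j)
  ... | tri< _ _ _ = refl
  ... | tri≈ ¬lt _ _ = contradiction lt ¬lt
  ... | tri> ¬lt _ _ = contradiction lt ¬lt

  keyed-> : ∀ {i j} → key j ℕ.< key i → keyed i j ≡ g j i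
  keyed-> {i} {j} gt with ℕ.<-cmp (key i) (key j)
  ... | tri< _ _ ¬gt = contradiction gt ¬gt
  ... | tri≈ _ _ ¬gt = contradiction gt ¬gt
  ... | tri> _ _ _ = refl

  keyed-≈ : ∀ {i j} → key i ≡ key j → keyed i j ≡ false
  keyed-≈ {i} {j} eq with ℕ.<-cmp (key i) (key j)
  ... | tri< _ ¬eq _ = contradiction eq ¬eq
  ... | tri≈ _ _ _ = refl
  ... | tri> _ ¬eq _ = contradiction eq ¬eq

  keyed-sym : ∀ i j → keyed i j ≡ keyed j i
  keyed-sym i j with ℕ.<-cmp (key i) (key j)
  ... | tri< lt _ _ = sym (keyed-> lt)
  ... | tri≈ _ eq _ = sym (keyed-≈ (sym eq))
  ... | tri> _ _ gt = sym (keyed-< gt)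

keyedColouring : (G : OGraph) → (Fin (size G) → ℕ) → (Fin (size G) → Fin (size G) → Bool) →
  Colouring G
keyedColouring G key g = record { col = keyed key g ; col-sym = keyed-sym key g }

colourIf : {A : Set} → Dec A → Bool → Bool
colourIf A? b = if does A? then b else not b

colourIf-≡ : ∀ {A : Set} {b} (A? : Dec A) → colourIf A? b ≡ b → A
colourIf-≡ (yes a) _ = a
colourIf-≡ (no _) eq = contradiction (sym eq) (not-¬ refl)

colourIf-not : ∀ {A : Set} {b} (A? : Dec A) → colourIf A? b ≡ not b → ¬ A
colourIf-not (yes _) eq = contradiction eq (not-¬ refl)
colourIf-not (no ¬a) _ = ¬a

sameSide⇒sides≡ : ∀ {m n} {f : Fin m → Fin n} → StrictMono f → ∀ {a x c} → SameSide a x c →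
  does (f a <? f x) ≡ does (f c <? f x)
sameSide⇒sides≡ mono (inj₁ (a<x , c<x)) =
  trans (dec-true (_ <? _) (mono _ _ a<x)) (sym (dec-true (_ <? _) (mono _ _ c<x)))
sameSide⇒sides≡ mono (inj₂ (x<a , x<c)) =
  trans (dec-false (_ <? _) (<-asym (mono _ _ x<a)))
        (sym (dec-false (_ <? _) (<-asym (mono _ _ x<c))))

module Rooted (F : OGraph) (ρ : Rooting F ⊤) where
  open Rooting ρ

  private
    V : Set
    V = Fin (size F)

  Parent : V → V → Set
  Parent x p = Edge F x p × rank x ℕ.< rank p

  Parent? : ∀ x p → Dec (Parent x p)
  Parent? x p = Edge? F x p ×-dec rank x ℕ.<? rank p

  edge⇒parent : ∀ {a b} → Edge F a b → Parent a b ⊎ Parent b a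
  edge⇒parent {a} {b} e with ℕ.<-cmp (rank a) (rank b)
  ... | tri< a<b _ _ = inj₁ (e , a<b)
  ... | tri≈ _ a≡b _ = contradiction a≡b (rank-≢ ∈⊤ ∈⊤ e)
  ... | tri> _ _ b<a = inj₂ (Edge-sym F e , b<a)

  parent-unique : ∀ {x p q} → Parent x p → Parent x q → p ≡ q
  parent-unique (xp , x<p) (xq , x<q) =
    trans (proj₂ (ascent ∈⊤) ∈⊤ xp x<p) (sym (proj₂ (ascent ∈⊤) ∈⊤ xq x<q))

  edge⇒parity≢ : ∀ {a b} → Edge F a b → parity a ≢ parity b
  edge⇒parity≢ = parity-≢ ∈⊤ ∈⊤

  oriented : (V → V → Bool) → Colouring F
  oriented = keyedColouring F rank

  oriented-up : ∀ {g x p} → Parent x p → col (oriented g) x p ≡ g x p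
  oriented-up (_ , x<p) = keyed-< rank _ x<p

  oriented-down : ∀ {g x p} → Parent x p → col (oriented g) p x ≡ g x p
  oriented-down (_ , x<p) = keyed-> rank _ x<p

  parityColouring : Colouring F
  parityColouring = oriented (λ x _ → parity x)

  parity-mono⇒leaf : ∀ {K β} ((f , _) : MonoCopy K F parityColouring β) →
    ∀ {z} → parity (f z) ≡ β → DegreeAtMostOne K z
  parity-mono⇒leaf {K} {β} (f , mono , edge) {z} fz≡β zw zw' =
    strictMono⇒injective mono (parent-unique (toParent zw) (toParent zw'))
    where
    toParent : ∀ {w} → Edge K z w → Parent (f z) (f w)
    toParent {w} zw with edge⇒parent (proj₁ (edge z w zw))
    ... | inj₁ up = up
    ... | inj₂ down = contradiction fw≡fz (edge⇒parity≢ (proj₁ down))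
      where
      fw≡fz : parity (f w) ≡ parity (f z)
      fw≡fz = trans (trans (sym (oriented-down down)) (proj₂ (edge z w zw))) (sym fz≡β)

  parity-mono⇒leafy : ∀ {K β} → MonoCopy K F parityColouring β →
    ∀ {x y} → Edge K x y → DegreeAtMostOne K x ⊎ DegreeAtMostOne K y
  parity-mono⇒leafy {K} {β} copy@(f , _ , edge) {x} {y} xy
    with parity (f x) ≟ᵇ β | parity (f y) ≟ᵇ β
  ... | yes fx≡β | _ = inj₁ (parity-mono⇒leaf {K} {β} copy {x} fx≡β)
  ... | _ | yes fy≡β = inj₂ (parity-mono⇒leaf {K} {β} copy {y} fy≡β)
  ... | no fx≢β | no fy≢β =
    contradiction (trans (¬-not fx≢β) (sym (¬-not fy≢β))) (edge⇒parity≢ (proj₁ (edge x y xy)))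

  orderColouring : Bool → Colouring F
  orderColouring b = oriented (λ x p → colourIf (x <? p) b)

  order-≡⇒parent : ∀ {b i j} → i < j → Edge F i j → col (orderColouring b) i j ≡ b → Parent i j
  order-≡⇒parent i<j e c≡b with edge⇒parent e
  ... | inj₁ up = up
  ... | inj₂ down =
    contradiction (colourIf-≡ (_ <? _) (trans (sym (oriented-down down)) c≡b)) (<-asym i<j)

  order-not⇒parent : ∀ {b i j} → i < j → Edge F i j → col (orderColouring b) i j ≡ not b →
    Parent j i
  order-not⇒parent i<j e c≡¬b with edge⇒parent e
  ... | inj₁ up = contradiction i<j (colourIf-not (_ <? _) (trans (sym (oriented-up up)) c≡¬b))
  ... | inj₂ down = down

  orderColouring-noRightCherry : ∀ K b → HasRightCherry K → ¬ MonoCopy K F (orderColouring b) b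
  orderColouring-noRightCherry K b (v , a , c , v<a , a<c , va , vc) (f , mono , edge) =
    <-irrefl (parent-unique (toParent v<a va) (toParent (<-trans v<a a<c) vc)) (mono a c a<c)
    where
    toParent : ∀ {x} → v < x → Edge K v x → Parent (f v) (f x)
    toParent {x} v<x vx = order-≡⇒parent (mono v x v<x) (proj₁ (edge v x vx)) (proj₂ (edge v x vx))

  orderColouring-noLeftCherry : ∀ K b → HasLeftCherry K → ¬ MonoCopy K F (orderColouring b) (not b)
  orderColouring-noLeftCherry K b (v , a , c , a<c , c<v , av , cv) (f , mono , edge) =
    <-irrefl (parent-unique (toParent (<-trans a<c c<v) av) (toParent c<v cv)) (mono a c a<c)
    where
    toParent : ∀ {x} → x < v → Edge K x v → Parent (f v) (f x)
    toParent {x} x<v xv =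
      order-not⇒parent (mono x v x<v) (proj₁ (edge x v xv)) (proj₂ (edge x v xv))

  leftParityColouring : Colouring F
  leftParityColouring = keyedColouring F toℕ (λ i _ → parity i)

  leftParityColouring-noMonotoneP3 : ∀ K β → Contains K monoP3 →
    ¬ MonoCopy K F leftParityColouring β
  leftParityColouring-noMonotoneP3 K β p3 copy =
    edge⇒parity≢ am (trans (leftColour a<m am-β) (sym (leftColour m<c mc-β)))
    where
    open MonotoneP3 (monoCopy⇒monotoneP3 {K} {F} {leftParityColouring} p3 copy)
    leftColour : ∀ {i j} → i < j → col leftParityColouring i j ≡ β → parity i ≡ β
    leftColour i<j = trans (sym (keyed-< toℕ _ i<j))

  parentOnLeft? : ∀ m → Dec (∃ λ y → Parent m y × y < m)
  parentOnLeft? m = any? λ y → Parent? m y ×-dec y <? m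

  parentOnLeft : V → Bool
  parentOnLeft m = does (parentOnLeft? m)

  parentOnLeft-parent : ∀ {m y} → Parent m y → parentOnLeft m ≡ does (y <? m)
  parentOnLeft-parent {m} {y} my with y <? m
  ... | yes y<m = trans (dec-true (parentOnLeft? m) (y , my , y<m)) (sym (dec-true (y <? m) y<m))
  ... | no y≮m = trans (dec-false (parentOnLeft? m) noLeftParent) (sym (dec-false (y <? m) y≮m))
    where
    noLeftParent : ¬ ∃ λ w → Parent m w × w < m
    noLeftParent (w , mw , w<m) = y≮m (subst (_< m) (parent-unique mw my) w<m)

  sideColouring : Bool → Colouring F
  sideColouring b = oriented (λ x p → colourIf (does (x <? p) ≟ᵇ parentOnLeft p) b)

  side-≡ : ∀ {b m x} → Edge F m x → col (sideColouring b) m x ≡ b → does (x <? m) ≡ parentOnLeft m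
  side-≡ mx c≡b with edge⇒parent mx
  ... | inj₁ up = sym (parentOnLeft-parent up)
  ... | inj₂ down = colourIf-≡ (_ ≟ᵇ _) (trans (sym (oriented-down down)) c≡b)

  side-not : ∀ {b m x y} → Parent m y → Edge F m x → x ≢ y → col (sideColouring b) m x ≡ not b →
    does (x <? m) ≢ does (y <? m)
  side-not my mx x≢y c≡¬b with edge⇒parent mx
  ... | inj₁ up = contradiction (parent-unique up my) x≢y
  ... | inj₂ down = λ sides≡ → colourIf-not (_ ≟ᵇ _) (trans (sym (oriented-down down)) c≡¬b)
                                 (trans sides≡ (sym (parentOnLeft-parent my)))

  sideColouring-noMonotoneP3 : ∀ K b → Contains K monoP3 → ¬ MonoCopy K F (sideColouring b) b
  sideColouring-noMonotoneP3 K b p3 copy = contradiction sides λ ()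
    where
    open MonotoneP3 (monoCopy⇒monotoneP3 {K} {F} {sideColouring b} p3 copy)
    open ≡-Reasoning
    sides : true ≡ false
    sides = begin
      true              ≡⟨ dec-true (a <? m) a<m ⟨
      does (a <? m)     ≡⟨ side-≡ (Edge-sym F am) (trans (col-sym (sideColouring b) m a) am-β) ⟩
      parentOnLeft m    ≡⟨ side-≡ mc mc-β ⟨
      does (c <? m)     ≡⟨ dec-false (c <? m) (<-asym m<c) ⟩
      false             ∎

  module _ (K : OGraph) (b : Bool) (zigzag : ZigzagP4 K) where
    open ZigzagP4 zigzag

    sideColouring-noZigzagP4 : ¬ MonoCopy K F (sideColouring b) (not b)
    sideColouring-noZigzagP4 (f , mono , edge) with edge⇒parent (proj₁ (edge q₂ q₃ q₂q₃))
    ... | inj₁ up = side-not up (Edge-sym F (proj₁ (edge q₁ q₂ q₁q₂)))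
                      (q₁≢q₃ ∘ strictMono⇒injective mono)
                      (trans (col-sym (sideColouring b) _ _) (proj₂ (edge q₁ q₂ q₁q₂)))
                      (sameSide⇒sides≡ mono bend₂)
    ... | inj₂ down = side-not down (proj₁ (edge q₃ q₄ q₃q₄))
                        (q₂≢q₄ ∘ sym ∘ strictMono⇒injective mono)
                        (proj₂ (edge q₃ q₄ q₃q₄))
                        (sym (sameSide⇒sides≡ mono bend₃))

  module _ (H H' : OGraph) where

    nonStarComponents⇒∉Ramsey : HasNonStarComponent H → HasNonStarComponent H' → ¬ InRamsey H H' F
    nonStarComponents⇒∉Ramsey (v , notStar) (v' , notStar') = colouring⇒∉Ramsey H H' parityColouring
      (λ red → notStar (leafy⇒componentIsStar H (parity-mono⇒leafy {H} red) v))
      (λ blue → notStar' (leafy⇒componentIsStar H' (parity-mono⇒leafy {H'} blue) v'))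

    rightLeftCherries⇒∉Ramsey : HasRightCherry H → HasLeftCherry H' → ¬ InRamsey H H' F
    rightLeftCherries⇒∉Ramsey right left = colouring⇒∉Ramsey H H' (orderColouring true)
      (orderColouring-noRightCherry H true right) (orderColouring-noLeftCherry H' true left)

    leftRightCherries⇒∉Ramsey : HasLeftCherry H → HasRightCherry H' → ¬ InRamsey H H' F
    leftRightCherries⇒∉Ramsey left right = colouring⇒∉Ramsey H H' (orderColouring false)
      (orderColouring-noLeftCherry H false left) (orderColouring-noRightCherry H' false right)

    monotoneP3s⇒∉Ramsey : Contains H monoP3 → Contains H' monoP3 → ¬ InRamsey H H' F
    monotoneP3s⇒∉Ramsey p3 p3' = colouring⇒∉Ramsey H H' leftParityColouring
      (leftParityColouring-noMonotoneP3 H true p3)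
      (leftParityColouring-noMonotoneP3 H' false p3')

    monotoneP3-P4⇒∉Ramsey : Contains H monoP3 → ContainsSomeP4 H' → ¬ InRamsey H H' F
    monotoneP3-P4⇒∉Ramsey p3 p4 with someP4⇒monoP3⊎zigzag H' p4
    ... | inj₁ p3' = monotoneP3s⇒∉Ramsey p3 p3'
    ... | inj₂ zigzag = colouring⇒∉Ramsey H H' (sideColouring true)
      (sideColouring-noMonotoneP3 H true p3) (sideColouring-noZigzagP4 H' true zigzag)

    P4-monotoneP3⇒∉Ramsey : ContainsSomeP4 H → Contains H' monoP3 → ¬ InRamsey H H' F
    P4-monotoneP3⇒∉Ramsey p4 p3' with someP4⇒monoP3⊎zigzag H p4
    ... | inj₁ p3 = monotoneP3s⇒∉Ramsey p3 p3'
    ... | inj₂ zigzag = colouring⇒∉Ramsey H H' (sideColouring false)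
      (sideColouring-noZigzagP4 H false zigzag) (sideColouring-noMonotoneP3 H' false p3')

lemma18 : (H H' : OGraph) → IsForest H → IsForest H' →
    ((HasNonStarComponent H × HasNonStarComponent H')
     ⊎ ((HasRightCherry H × HasLeftCherry H') ⊎ (HasLeftCherry H × HasRightCherry H'))
     ⊎ (Contains H monoP3 × Contains H' monoP3)
     ⊎ ((Contains H monoP3 × ContainsSomeP4 H') ⊎ (ContainsSomeP4 H × Contains H' monoP3))) →
    (F : OGraph) → IsForest F → ¬ InRamsey H H' F
lemma18 H H' _ _ (inj₁ (s , s')) F forest =
  Rooted.nonStarComponents⇒∉Ramsey F (forest⇒rooting F forest) H H' s s'
lemma18 H H' _ _ (inj₂ (inj₁ (inj₁ (r , l)))) F forest =
  Rooted.rightLeftCherries⇒∉Ramsey F (forest⇒rooting F forest) H H' r l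
lemma18 H H' _ _ (inj₂ (inj₁ (inj₂ (l , r)))) F forest =
  Rooted.leftRightCherries⇒∉Ramsey F (forest⇒rooting F forest) H H' l r
lemma18 H H' _ _ (inj₂ (inj₂ (inj₁ (p , p')))) F forest =
  Rooted.monotoneP3s⇒∉Ramsey F (forest⇒rooting F forest) H H' p p'
lemma18 H H' _ _ (inj₂ (inj₂ (inj₂ (inj₁ (p , q))))) F forest =
  Rooted.monotoneP3-P4⇒∉Ramsey F (forest⇒rooting F forest) H H' p q
lemma18 H H' _ _ (inj₂ (inj₂ (inj₂ (inj₂ (q , p))))) F forest =
  Rooted.P4-monotoneP3⇒∉Ramsey F (forest⇒rooting F forest) H H' q p
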